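{- Let $n$ be a positive integer and let $a,b$ be integers with $1 \le a < b < n$. Suppose that $a \neq \frac{n}{2}$ and $$b \notin \left\{\, n-a,\ \tfrac{n+a}{2},\ \tfrac{n}{2}+a,\ \tfrac{n}{2},\ 2a \,\right\}.$$ Then the generalized cyclic table $\mathscr{C}(n,a,b)$ is an $(n_3)$ combinatorial configuration.
   Context: The generalized cyclic table $\mathscr{C}(n,a,b)$, for $1 \le a < b < n$, has points $1,\dots,n$ (taken mod $n$). It has $n$ columns (lines), namely $\{j,\ j+a,\ j+b\}$ for $j = 1,\dots,n$, with entries reduced mod $n$. An $(n_3)$ combinatorial configuration is a collection of $n$ points and $n$ lines (blocks). Each line contains exactly $3$ points, each point lies on exactly $3$ lines, and any two distinct lines share at most one point. -}

module Defs where

open import Data.Nat using (ℕ; _+_; _≤_; NonZero)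
open import Data.Nat.DivMod using (_mod_)
open import Data.Fin using (Fin; toℕ)
open import Data.Fin.Subset using (Subset; ⁅_⁆; _∪_; _∩_; ∣_∣)
open import Data.Vec using (tabulate; lookup)
open import Data.Product using (_×_)
open import Relation.Binary.PropositionalEquality using (_≡_; _≢_)

linesThrough : ∀ {n} → (Fin n → Subset n) → Fin n → Subset n
linesThrough L x = tabulate (λ j → lookup (L j) x)

IsN3Configuration : (n : ℕ) → (Fin n → Subset n) → Set
IsN3Configuration n L =
  (∀ j → ∣ L j ∣ ≡ 3) ×
  (∀ x → ∣ linesThrough L x ∣ ≡ 3) ×
  (∀ j k → j ≢ k → ∣ L j ∩ L k ∣ ≤ 1)

-- Generalized cyclic table C(n,a,b): points are residues mod n (represented
-- as Fin n, i.e. 0..n-1 instead of 1..n), column j is {j, j+a, j+b} mod n.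
cyclicTable : (n a b : ℕ) → .{{_ : NonZero n}} → Fin n → Subset n
cyclicTable n a b j =
  ⁅ toℕ j mod n ⁆ ∪ (⁅ (toℕ j + a) mod n ⁆ ∪ ⁅ (toℕ j + b) mod n ⁆)

-- The line j of C(n,a,b) is the translate j + D of D = {0, a, b} in ℤ/n, so every
-- line has three points and, dually, the lines through x are x − d for d ∈ D.
-- Lines j + D and k + D meet in j + d = k + d′ only when k − j ≡ d − d′, so two
-- distinct lines share at most one point once the six differences ±a, ±b, ±(b − a)
-- are distinct mod n.  Writing them as the edge lengths ℓ ∈ {a, b, b − a} of the
-- triangle D and their complements n − ℓ, this says: the lengths are distinct
-- (b ≠ 2a), and no two of them, equal or not, sum to n (the remaining hypotheses,
-- with a + (b − a) = b < n for free).

module Submission where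

open import Defs
open import Data.Nat using (ℕ; suc; _+_; _*_; _∸_; _≤_; _<_; z≤n; NonZero)
open import Data.Nat.Properties
open import Data.Nat.DivMod using (_%_; _mod_; %-distribˡ-+; [m+n]%n≡m%n; m%n%n≡m%n; m%n≤n; m<n⇒m%n≡m)
open import Data.Fin using (Fin; zero; suc; toℕ)
open import Data.Fin.Properties using (toℕ-injective; toℕ<n; toℕ-fromℕ<)
open import Data.Fin.Subset using (Subset; inside; outside; ⁅_⁆; _∪_; _∩_; ∣_∣; _∈_; _∉_; _⊆_)
open import Data.Fin.Subset.Properties
  using (x∈⁅x⁆; x∈⁅y⁆⇒x≡y; ∣⁅x⁆∣≡1; ∪-identityˡ; x∈p∪q⁺; x∈p∪q⁻; x∈p∩q⁻;
         ⊆-antisym; p⊆q⇒∣p∣≤∣q∣; nonempty?; Empty-unique; ∣⊥∣≡0)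
open import Data.Vec using (_∷_; lookup; here; there)
open import Data.Vec.Properties using (lookup∘tabulate; tabulate-cong; []=⇒lookup; lookup⇒[]=)
open import Data.Product using (_×_; _,_; ∃-syntax)
open import Data.Sum using (inj₁; inj₂)
open import Function using (_∘_; case_of_)
open import Function.Definitions using (Injective)
open import Relation.Nullary using (yes; no; contradiction)
open import Relation.Binary.PropositionalEquality

x∉p⇒∣⁅x⁆∪p∣≡1+∣p∣ : ∀ {m} {x : Fin m} {p : Subset m} → x ∉ p → ∣ ⁅ x ⁆ ∪ p ∣ ≡ suc ∣ p ∣
x∉p⇒∣⁅x⁆∪p∣≡1+∣p∣ {x = zero}  {inside  ∷ p} x∉p = contradiction here x∉p
x∉p⇒∣⁅x⁆∪p∣≡1+∣p∣ {x = zero}  {outside ∷ p} _   = cong (suc ∘ ∣_∣) (∪-identityˡ p)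
x∉p⇒∣⁅x⁆∪p∣≡1+∣p∣ {x = suc x} {inside  ∷ p} x∉p = cong suc (x∉p⇒∣⁅x⁆∪p∣≡1+∣p∣ (x∉p ∘ there))
x∉p⇒∣⁅x⁆∪p∣≡1+∣p∣ {x = suc x} {outside ∷ p} x∉p = x∉p⇒∣⁅x⁆∪p∣≡1+∣p∣ (x∉p ∘ there)

subsingleton⇒∣p∣≤1 : ∀ {m} {p : Subset m} → (∀ {x y} → x ∈ p → y ∈ p → x ≡ y) → ∣ p ∣ ≤ 1
subsingleton⇒∣p∣≤1 {m} {p} unique with nonempty? p
... | no  p≡∅       = ≤-trans (≤-reflexive (trans (cong ∣_∣ (Empty-unique p≡∅)) (∣⊥∣≡0 m))) z≤n
... | yes (x , x∈p) = ≤-trans (p⊆q⇒∣p∣≤∣q∣ p⊆⁅x⁆) (≤-reflexive (∣⁅x⁆∣≡1 x))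
  where
  p⊆⁅x⁆ : p ⊆ ⁅ x ⁆
  p⊆⁅x⁆ y∈p = subst (_∈ ⁅ x ⁆) (unique x∈p y∈p) (x∈⁅x⁆ x)

data Row : Set where
  row₀ row₁ row₂ : Row

image : ∀ {m} → (Row → Fin m) → Subset m
image f = ⁅ f row₀ ⁆ ∪ (⁅ f row₁ ⁆ ∪ ⁅ f row₂ ⁆)

module _ {m} (f : Row → Fin m) where

  ∈-image⁺ : ∀ {y} r → y ≡ f r → y ∈ image f
  ∈-image⁺ row₀ refl = x∈p∪q⁺ (inj₁ (x∈⁅x⁆ _))
  ∈-image⁺ row₁ refl = x∈p∪q⁺ (inj₂ (x∈p∪q⁺ (inj₁ (x∈⁅x⁆ _))))
  ∈-image⁺ row₂ refl = x∈p∪q⁺ (inj₂ (x∈p∪q⁺ {p = ⁅ f row₁ ⁆} (inj₂ (x∈⁅x⁆ _))))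

  ∈-image⁻ : ∀ {y} → y ∈ image f → ∃[ r ] y ≡ f r
  ∈-image⁻ y∈ with x∈p∪q⁻ ⁅ f row₀ ⁆ _ y∈
  ... | inj₁ y∈₀ = row₀ , x∈⁅y⁆⇒x≡y _ y∈₀
  ... | inj₂ y∈₁₂ with x∈p∪q⁻ ⁅ f row₁ ⁆ ⁅ f row₂ ⁆ y∈₁₂
  ...   | inj₁ y∈₁ = row₁ , x∈⁅y⁆⇒x≡y _ y∈₁
  ...   | inj₂ y∈₂ = row₂ , x∈⁅y⁆⇒x≡y _ y∈₂

  ∣image∣≡3 : Injective _≡_ _≡_ f → ∣ image f ∣ ≡ 3
  ∣image∣≡3 f-inj = begin
    ∣ ⁅ f row₀ ⁆ ∪ (⁅ f row₁ ⁆ ∪ ⁅ f row₂ ⁆) ∣ ≡⟨ x∉p⇒∣⁅x⁆∪p∣≡1+∣p∣ f₀∉ ⟩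
    suc ∣ ⁅ f row₁ ⁆ ∪ ⁅ f row₂ ⁆ ∣             ≡⟨ cong suc (x∉p⇒∣⁅x⁆∪p∣≡1+∣p∣ f₁∉) ⟩
    2 + ∣ ⁅ f row₂ ⁆ ∣                          ≡⟨ cong (2 +_) (∣⁅x⁆∣≡1 (f row₂)) ⟩
    3                                           ∎
    where
    open ≡-Reasoning
    f₀∉ : f row₀ ∉ ⁅ f row₁ ⁆ ∪ ⁅ f row₂ ⁆
    f₀∉ f₀∈ with x∈p∪q⁻ ⁅ f row₁ ⁆ ⁅ f row₂ ⁆ f₀∈
    ... | inj₁ f₀∈₁ = case f-inj {row₀} {row₁} (x∈⁅y⁆⇒x≡y _ f₀∈₁) of λ ()
    ... | inj₂ f₀∈₂ = case f-inj {row₀} {row₂} (x∈⁅y⁆⇒x≡y _ f₀∈₂) of λ ()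
    f₁∉ : f row₁ ∉ ⁅ f row₂ ⁆
    f₁∉ f₁∈ = case f-inj {row₁} {row₂} (x∈⁅y⁆⇒x≡y _ f₁∈) of λ ()

module _ {n} {L : Fin n → Subset n} {x j : Fin n} where

  ∈-linesThrough⁺ : x ∈ L j → j ∈ linesThrough L x
  ∈-linesThrough⁺ x∈ = lookup⇒[]= j _ (trans (lookup∘tabulate _ j) ([]=⇒lookup x∈))

  ∈-linesThrough⁻ : j ∈ linesThrough L x → x ∈ L j
  ∈-linesThrough⁻ j∈ = lookup⇒[]= x (L j) (trans (sym (lookup∘tabulate _ j)) ([]=⇒lookup j∈))

IsN3Configuration-resp-≗ : ∀ {n} {L L′ : Fin n → Subset n} →
  (∀ j → L j ≡ L′ j) → IsN3Configuration n L → IsN3Configuration n L′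
IsN3Configuration-resp-≗ L≗L′ (lines , points , meets) =
  (λ j → trans (cong ∣_∣ (sym (L≗L′ j))) (lines j)) ,
  (λ x → trans (cong ∣_∣ (tabulate-cong (λ j → cong (λ p → lookup p x) (sym (L≗L′ j))))) (points x)) ,
  (λ j k j≢k → subst (_≤ 1) (cong ∣_∣ (cong₂ _∩_ (L≗L′ j) (L≗L′ k))) (meets j k j≢k))

module Modular (n : ℕ) .{{_ : NonZero n}} where

  open ≡-Reasoning

  infix 4 _≈_
  _≈_ : ℕ → ℕ → Set
  x ≈ y = x % n ≡ y % n

  %-≈ : ∀ x → x % n ≈ x
  %-≈ x = m%n%n≡m%n x n

  n+-≈ : ∀ x → n + x ≈ x
  n+-≈ x = trans (cong (_% n) (+-comm n x)) ([m+n]%n≡m%n x n)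

  +-cong-≈ : ∀ {x x′ y y′} → x ≈ x′ → y ≈ y′ → x + y ≈ x′ + y′
  +-cong-≈ {x} {x′} {y} {y′} x≈x′ y≈y′ = begin
    (x + y) % n           ≡⟨ %-distribˡ-+ x y n ⟩
    (x % n + y % n) % n   ≡⟨ cong₂ (λ u w → (u + w) % n) x≈x′ y≈y′ ⟩
    (x′ % n + y′ % n) % n ≡⟨ %-distribˡ-+ x′ y′ n ⟨
    (x′ + y′) % n         ∎

  -- n ∸ z % n is an additive inverse of z.
  +-cancelˡ-≈ : ∀ z {x y} → z + x ≈ z + y → x ≈ y
  +-cancelˡ-≈ z {x} {y} z+x≈z+y = trans (sym (undo x)) (trans (+-cong-≈ {n ∸ z % n} refl z+x≈z+y) (undo y))
    where
    undo : ∀ x → (n ∸ z % n) + (z + x) ≈ x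
    undo x = begin
      ((n ∸ z % n) + (z + x)) % n     ≡⟨ cong (_% n) (+-assoc (n ∸ z % n) z x) ⟨
      ((n ∸ z % n) + z + x) % n       ≡⟨ +-cong-≈ (+-cong-≈ {n ∸ z % n} refl (sym (%-≈ z))) refl ⟩
      ((n ∸ z % n) + z % n + x) % n   ≡⟨ cong (λ t → (t + x) % n) (m∸n+n≡m (m%n≤n z n)) ⟩
      (n + x) % n                     ≡⟨ n+-≈ x ⟩
      x % n                           ∎

  +-cancelʳ-≈ : ∀ z {x y} → x + z ≈ y + z → x ≈ y
  +-cancelʳ-≈ z {x} {y} x+z≈y+z =
    +-cancelˡ-≈ z (trans (cong (_% n) (+-comm z x)) (trans x+z≈y+z (cong (_% n) (+-comm y z))))

  ≈⇒≡ : ∀ {x y} → x < n → y < n → x ≈ y → x ≡ y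
  ≈⇒≡ x<n y<n x≈y = trans (sym (m<n⇒m%n≡m x<n)) (trans x≈y (m<n⇒m%n≡m y<n))

  infixl 6 _⊕_ _⊖_
  _⊕_ : Fin n → ℕ → Fin n
  j ⊕ m = (toℕ j + m) mod n

  _⊖_ : Fin n → ℕ → Fin n
  x ⊖ m = x ⊕ (n ∸ m)

  toℕ-⊕ : ∀ j m → toℕ (j ⊕ m) ≡ (toℕ j + m) % n
  toℕ-⊕ j m = toℕ-fromℕ< _

  ⊕-≈ : ∀ {j k m m′} → j ⊕ m ≡ k ⊕ m′ → toℕ j + m ≈ toℕ k + m′
  ⊕-≈ {j} {k} {m} {m′} eq = trans (sym (toℕ-⊕ j m)) (trans (cong toℕ eq) (toℕ-⊕ k m′))

  ⊕-cancelʳ : ∀ {j k m} → j ⊕ m ≡ k ⊕ m → j ≡ k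
  ⊕-cancelʳ {j} {k} {m} eq = toℕ-injective (≈⇒≡ (toℕ<n j) (toℕ<n k) (+-cancelʳ-≈ m (⊕-≈ {j} {k} eq)))

  ⊕-inverse : ∀ {p q} → p + q ≡ n → ∀ {x y} → y ≡ x ⊕ p → x ≡ y ⊕ q
  ⊕-inverse {p} {q} p+q≡n {x} {y} refl = toℕ-injective (begin
    toℕ x                          ≡⟨ m<n⇒m%n≡m (toℕ<n x) ⟨
    toℕ x % n                      ≡⟨ n+-≈ (toℕ x) ⟨
    (n + toℕ x) % n                ≡⟨ cong (_% n) (trans (+-comm n (toℕ x)) (cong (toℕ x +_) (sym p+q≡n))) ⟩
    (toℕ x + (p + q)) % n          ≡⟨ cong (_% n) (+-assoc (toℕ x) p q) ⟨
    (toℕ x + p + q) % n            ≡⟨ +-cong-≈ (%-≈ (toℕ x + p)) refl ⟨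
    ((toℕ x + p) % n + q) % n      ≡⟨ cong (λ t → (t + q) % n) (toℕ-⊕ x p) ⟨
    (toℕ (x ⊕ p) + q) % n          ≡⟨ toℕ-⊕ (x ⊕ p) q ⟨
    toℕ (x ⊕ p ⊕ q)                ∎)

  ⊕⇒⊖ : ∀ {m x y} → m ≤ n → y ≡ x ⊕ m → x ≡ y ⊖ m
  ⊕⇒⊖ m≤n = ⊕-inverse (m+[n∸m]≡n m≤n)

  ⊖⇒⊕ : ∀ {m x y} → m ≤ n → x ≡ y ⊖ m → y ≡ x ⊕ m
  ⊖⇒⊕ m≤n = ⊕-inverse (m∸n+n≡m m≤n)

  ⊖-⊕ : ∀ {m} x → m ≤ n → x ⊖ m ⊕ m ≡ x
  ⊖-⊕ x m≤n = sym (⊖⇒⊕ m≤n refl)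

data Edge : Set where
  e₀₁ e₀₂ e₁₂ : Edge

lower upper : Edge → Row
lower e₀₁ = row₀
lower e₀₂ = row₀
lower e₁₂ = row₁
upper e₀₁ = row₁
upper e₀₂ = row₂
upper e₁₂ = row₂

data Chord : Set where
  up down : Edge → Chord

source target : Chord → Row
source (up e)   = lower e
source (down e) = upper e
target (up e)   = upper e
target (down e) = lower e

chord : ∀ {r s} → r ≢ s → ∃[ c ] source c ≡ r × target c ≡ s
chord {row₀} {row₀} r≢s = contradiction refl r≢s
chord {row₀} {row₁} _   = up e₀₁ , refl , refl
chord {row₀} {row₂} _   = up e₀₂ , refl , refl
chord {row₁} {row₀} _   = down e₀₁ , refl , refl
chord {row₁} {row₁} r≢s = contradiction refl r≢s
chord {row₁} {row₂} _   = up e₁₂ , refl , refl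
chord {row₂} {row₀} _   = down e₀₂ , refl , refl
chord {row₂} {row₁} _   = down e₁₂ , refl , refl
chord {row₂} {row₂} r≢s = contradiction refl r≢s

twice : ∀ m → 2 * m ≡ m + m
twice m = cong (m +_) (+-identityʳ m)

module CyclicTable (n a b : ℕ) .{{_ : NonZero n}} (0<a : 0 < a) (a<b : a < b) (b<n : b < n) where

  open Modular n
  open ≡-Reasoning

  offset : Row → ℕ
  offset row₀ = 0
  offset row₁ = a
  offset row₂ = b

  0<b : 0 < b
  0<b = <-trans 0<a a<b

  offset<n : ∀ r → offset r < n
  offset<n row₀ = <-trans 0<b b<n
  offset<n row₁ = <-trans a<b b<n
  offset<n row₂ = b<n

  offset≤n : ∀ r → offset r ≤ n
  offset≤n r = <⇒≤ (offset<n r)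

  offset-injective : Injective _≡_ _≡_ offset
  offset-injective {row₀} {row₀} _  = refl
  offset-injective {row₀} {row₁} eq = contradiction eq (<⇒≢ 0<a)
  offset-injective {row₀} {row₂} eq = contradiction eq (<⇒≢ 0<b)
  offset-injective {row₁} {row₀} eq = contradiction eq (>⇒≢ 0<a)
  offset-injective {row₁} {row₁} _  = refl
  offset-injective {row₁} {row₂} eq = contradiction eq (<⇒≢ a<b)
  offset-injective {row₂} {row₀} eq = contradiction eq (>⇒≢ 0<b)
  offset-injective {row₂} {row₁} eq = contradiction eq (>⇒≢ a<b)
  offset-injective {row₂} {row₂} _  = refl

  line : Fin n → Subset n
  line j = image (λ r → j ⊕ offset r)

  line≗cyclicTable : ∀ j → line j ≡ cyclicTable n a b j
  line≗cyclicTable j =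
    cong (λ i → ⁅ i mod n ⁆ ∪ (⁅ (toℕ j + a) mod n ⁆ ∪ ⁅ (toℕ j + b) mod n ⁆)) (+-identityʳ (toℕ j))

  ⊕-offset-injective : ∀ {j} → Injective _≡_ _≡_ (λ r → j ⊕ offset r)
  ⊕-offset-injective {j} {r} {s} eq =
    offset-injective (≈⇒≡ (offset<n r) (offset<n s) (+-cancelˡ-≈ (toℕ j) (⊕-≈ {j} {j} eq)))

  pencil : Fin n → Subset n
  pencil x = image (λ r → x ⊖ offset r)

  ⊖-offset-injective : ∀ {x} → Injective _≡_ _≡_ (λ r → x ⊖ offset r)
  ⊖-offset-injective {x} {r} {s} eq = ⊕-offset-injective (begin
    x ⊖ offset r ⊕ offset r ≡⟨ ⊖-⊕ x (offset≤n r) ⟩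
    x                       ≡⟨ ⊖-⊕ x (offset≤n s) ⟨
    x ⊖ offset s ⊕ offset s ≡⟨ cong (_⊕ offset s) eq ⟨
    x ⊖ offset r ⊕ offset s ∎)

  linesThrough-line : ∀ x → linesThrough line x ≡ pencil x
  linesThrough-line x = ⊆-antisym line∋x⇒∈pencil ∈pencil⇒line∋x
    where
    line∋x⇒∈pencil : linesThrough line x ⊆ pencil x
    line∋x⇒∈pencil {j} j∈ with r , x≡ ← ∈-image⁻ (λ r → j ⊕ offset r) (∈-linesThrough⁻ {L = line} j∈) =
      ∈-image⁺ (λ r → x ⊖ offset r) r (⊕⇒⊖ (offset≤n r) x≡)
    ∈pencil⇒line∋x : pencil x ⊆ linesThrough line x
    ∈pencil⇒line∋x {j} j∈ with r , j≡ ← ∈-image⁻ (λ r → x ⊖ offset r) j∈ =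
      ∈-linesThrough⁺ {L = line} (∈-image⁺ (λ r → j ⊕ offset r) r (⊖⇒⊕ (offset≤n r) j≡))

  len : Edge → ℕ
  len e = offset (upper e) ∸ offset (lower e)

  lower<upper : ∀ e → offset (lower e) < offset (upper e)
  lower<upper e₀₁ = 0<a
  lower<upper e₀₂ = 0<b
  lower<upper e₁₂ = a<b

  len≤n : ∀ e → len e ≤ n
  len≤n e = ≤-trans (m∸n≤m (offset (upper e)) (offset (lower e))) (offset≤n (upper e))

  -- gap c is the representative in [0, n) of offset (target c) − offset (source c).
  gap : Chord → ℕ
  gap (up e)   = len e
  gap (down e) = n ∸ len e

  gap<n : ∀ c → gap c < n
  gap<n (up e)   = ≤-<-trans (m∸n≤m (offset (upper e)) (offset (lower e))) (offset<n (upper e))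
  gap<n (down e) = ∸-monoʳ-< (m<n⇒0<n∸m (lower<upper e)) (len≤n e)

  source+gap≈target : ∀ c → offset (source c) + gap c ≈ offset (target c)
  source+gap≈target (up e)   = cong (_% n) (m+[n∸m]≡n (<⇒≤ (lower<upper e)))
  source+gap≈target (down e) = begin
    (offset (upper e) + (n ∸ len e)) % n            ≡⟨ cong (λ t → (t + (n ∸ len e)) % n) (m+[n∸m]≡n (<⇒≤ (lower<upper e))) ⟨
    (offset (lower e) + len e + (n ∸ len e)) % n    ≡⟨ cong (_% n) (+-assoc (offset (lower e)) (len e) _) ⟩
    (offset (lower e) + (len e + (n ∸ len e))) % n  ≡⟨ cong (λ t → (offset (lower e) + t) % n) (m+[n∸m]≡n (len≤n e)) ⟩
    (offset (lower e) + n) % n                      ≡⟨ [m+n]%n≡m%n (offset (lower e)) n ⟩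
    offset (lower e) % n                            ∎

  common-point-chord : ∀ {j k r s} → j ≢ k → j ⊕ offset r ≡ k ⊕ offset s →
                       ∃[ c ] target c ≡ r × toℕ j + gap c ≈ toℕ k
  common-point-chord {j} {k} {r} {s} j≢k meet
    with c , c-s , c-r ← chord {s} {r} (λ { refl → j≢k (⊕-cancelʳ meet) }) =
    c , c-r , +-cancelʳ-≈ (offset s) (begin
      (toℕ j + gap c + offset s) % n  ≡⟨ cong (_% n) (trans (+-assoc (toℕ j) _ _) (cong (toℕ j +_) (+-comm (gap c) (offset s)))) ⟩
      (toℕ j + (offset s + gap c)) % n ≡⟨ +-cong-≈ {toℕ j} refl (subst₂ (λ u w → offset u + gap c ≈ offset w) c-s c-r (source+gap≈target c)) ⟩
      (toℕ j + offset r) % n          ≡⟨ ⊕-≈ {j} {k} meet ⟩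
      (toℕ k + offset s) % n          ∎)

  module _ (len-injective : Injective _≡_ _≡_ len) (len+len≢n : ∀ e e′ → len e + len e′ ≢ n) where

    gap-injective : Injective _≡_ _≡_ gap
    gap-injective {up e}   {up e′}   eq = cong up (len-injective eq)
    gap-injective {up e}   {down e′} eq = contradiction (trans (cong (_+ len e′) eq) (m∸n+n≡m (len≤n e′))) (len+len≢n e e′)
    gap-injective {down e} {up e′}   eq = contradiction (trans (cong (_+ len e) (sym eq)) (m∸n+n≡m (len≤n e))) (len+len≢n e′ e)
    gap-injective {down e} {down e′} eq = cong down (len-injective (∸-cancelˡ-≡ (len≤n e) (len≤n e′) eq))

    ∣line∩line∣≤1 : ∀ j k → j ≢ k → ∣ line j ∩ line k ∣ ≤ 1
    ∣line∩line∣≤1 j k j≢k = subsingleton⇒∣p∣≤1 common-points-equal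
      where
      on-both : ∀ {y} → y ∈ line j ∩ line k → ∃[ r ] y ≡ j ⊕ offset r × (∃[ c ] target c ≡ r × toℕ j + gap c ≈ toℕ k)
      on-both {y} y∈ with y∈j , y∈k ← x∈p∩q⁻ (line j) (line k) y∈
        with r , y≡j⊕ ← ∈-image⁻ (λ r → j ⊕ offset r) y∈j
           | s , y≡k⊕ ← ∈-image⁻ (λ s → k ⊕ offset s) y∈k =
        r , y≡j⊕ , common-point-chord j≢k (trans (sym y≡j⊕) y≡k⊕)

      common-points-equal : ∀ {y z} → y ∈ line j ∩ line k → z ∈ line j ∩ line k → y ≡ z
      common-points-equal y∈ z∈
        with r , y≡ , c , c-r , jc≈k ← on-both y∈
           | r′ , z≡ , c′ , c′-r′ , jc′≈k ← on-both z∈ =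
        trans y≡ (trans (cong (λ t → j ⊕ offset t) r≡r′) (sym z≡))
        where
        c≡c′ : c ≡ c′
        c≡c′ = gap-injective (≈⇒≡ (gap<n c) (gap<n c′) (+-cancelˡ-≈ (toℕ j) (trans jc≈k (sym jc′≈k))))
        r≡r′ : r ≡ r′
        r≡r′ = trans (sym c-r) (trans (cong target c≡c′) c′-r′)

    line-isN3Configuration : IsN3Configuration n line
    line-isN3Configuration =
      (λ j → ∣image∣≡3 (λ r → j ⊕ offset r) ⊕-offset-injective) ,
      (λ x → trans (cong ∣_∣ (linesThrough-line x)) (∣image∣≡3 (λ r → x ⊖ offset r) ⊖-offset-injective)) ,
      ∣line∩line∣≤1

  b∸a+a≡b : b ∸ a + a ≡ b
  b∸a+a≡b = m∸n+n≡m (<⇒≤ a<b)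

  b∸a<b : b ∸ a < b
  b∸a<b = ∸-monoʳ-< 0<a (<⇒≤ a<b)

  len-injective : b ≢ 2 * a → Injective _≡_ _≡_ len
  len-injective b≢2a = injective
    where
    b≡2a : a ≡ b ∸ a → b ≡ 2 * a
    b≡2a a≡b∸a = begin
      b         ≡⟨ b∸a+a≡b ⟨
      b ∸ a + a ≡⟨ cong (_+ a) a≡b∸a ⟨
      a + a     ≡⟨ twice a ⟨
      2 * a     ∎
    injective : Injective _≡_ _≡_ len
    injective {e₀₁} {e₀₁} _  = refl
    injective {e₀₁} {e₀₂} eq = contradiction eq (<⇒≢ a<b)
    injective {e₀₁} {e₁₂} eq = contradiction (b≡2a eq) b≢2a
    injective {e₀₂} {e₀₁} eq = contradiction eq (>⇒≢ a<b)
    injective {e₀₂} {e₀₂} _  = refl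
    injective {e₀₂} {e₁₂} eq = contradiction eq (>⇒≢ b∸a<b)
    injective {e₁₂} {e₀₁} eq = contradiction (b≡2a (sym eq)) b≢2a
    injective {e₁₂} {e₀₂} eq = contradiction eq (<⇒≢ b∸a<b)
    injective {e₁₂} {e₁₂} _  = refl

  len+len≢n : 2 * a ≢ n → a + b ≢ n → 2 * b ≢ n → 2 * b ≢ n + a → 2 * b ≢ n + 2 * a →
              ∀ e e′ → len e + len e′ ≢ n
  len+len≢n 2a≢n a+b≢n 2b≢n 2b≢n+a 2b≢n+2a = no-complement
    where
    b≢n : b ≢ n
    b≢n = <⇒≢ b<n
    2b≡n+a : b + (b ∸ a) ≡ n → 2 * b ≡ n + a
    2b≡n+a eq = begin
      2 * b             ≡⟨ twice b ⟩
      b + b             ≡⟨ cong (b +_) b∸a+a≡b ⟨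
      b + (b ∸ a + a)   ≡⟨ +-assoc b (b ∸ a) a ⟨
      b + (b ∸ a) + a   ≡⟨ cong (_+ a) eq ⟩
      n + a             ∎
    2b≡n+2a : (b ∸ a) + (b ∸ a) ≡ n → 2 * b ≡ n + 2 * a
    2b≡n+2a eq = begin
      2 * b                    ≡⟨ cong (2 *_) b∸a+a≡b ⟨
      2 * (b ∸ a + a)          ≡⟨ *-distribˡ-+ 2 (b ∸ a) a ⟩
      2 * (b ∸ a) + 2 * a      ≡⟨ cong (_+ 2 * a) (trans (twice (b ∸ a)) eq) ⟩
      n + 2 * a                ∎
    no-complement : ∀ e e′ → len e + len e′ ≢ n
    no-complement e₀₁ e₀₁ eq = 2a≢n (trans (twice a) eq)
    no-complement e₀₁ e₀₂ eq = a+b≢n eq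
    no-complement e₀₁ e₁₂ eq = b≢n (trans (sym (m+[n∸m]≡n (<⇒≤ a<b))) eq)
    no-complement e₀₂ e₀₁ eq = a+b≢n (trans (+-comm a b) eq)
    no-complement e₀₂ e₀₂ eq = 2b≢n (trans (twice b) eq)
    no-complement e₀₂ e₁₂ eq = 2b≢n+a (2b≡n+a eq)
    no-complement e₁₂ e₀₁ eq = b≢n (trans (sym b∸a+a≡b) eq)
    no-complement e₁₂ e₀₂ eq = 2b≢n+a (2b≡n+a (trans (+-comm b (b ∸ a)) eq))
    no-complement e₁₂ e₁₂ eq = 2b≢n+2a (2b≡n+2a eq)

mainTheorem6 : (n a b : ℕ) → .{{_ : NonZero n}} →
    1 ≤ a → a < b → b < n →
    2 * a ≢ n →
    a + b ≢ n →
    2 * b ≢ n + a →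
    2 * b ≢ n + 2 * a →
    2 * b ≢ n →
    b ≢ 2 * a →
    IsN3Configuration n (cyclicTable n a b)
mainTheorem6 n a b 0<a a<b b<n 2a≢n a+b≢n 2b≢n+a 2b≢n+2a 2b≢n b≢2a =
  IsN3Configuration-resp-≗ line≗cyclicTable
    (line-isN3Configuration (len-injective b≢2a) (len+len≢n 2a≢n a+b≢n 2b≢n 2b≢n+a 2b≢n+2a))
  where open CyclicTable n a b 0<a a<b b<n
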